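{- Let $G=(V,E)$ be a fork-free graph, $I$ an independent set of $G$, and $c\in V$ a vertex adjacent to at least three vertices of $I$. Then $\{c\}$ is permanently blocked with respect to $I$.
   Context: Two independent sets $A,B$ are TS-adjacent if $A\setminus B=\{x\}$, $B\setminus A=\{y\}$ and $xy\in E$; $A\leftrightsquigarrow B$ means there is a sequence of independent sets from $A$ to $B$ with consecutive sets TS-adjacent. A fork is the claw with one edge subdivided once. A set $X\subseteq V$ is locally blocked with respect to $I$ if every vertex of $X$ is adjacent to at least two vertices of $I$. For $u\in V$ and $X\subseteq V\setminus\{u\}$, a vertex $v\notin X\cup\{u\}$ is an $X$-twin of $u$ if $uv\in E$ and $N(v)\cap X=N(u)\cap X$. For an independent set $I'$ and $u\in I'$, an $I'$-free neighbor of $u$ is a vertex $v\notin I'$ adjacent to $u$ such that $(I'\setminus\{u\})\cup\{v\}$ is independent. $X$ is permanently blocked with respect to $I$ if it is locally blocked with respect to $I$ and for every independent set $I'$ with $I\leftrightsquigarrow I'$ and every $u\in N(X)\cap I'$, every $I'$-free neighbor of $u$ is an $X$-twin of $u$. -}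

module Defs where

open import Data.Nat using (ℕ)
open import Data.Fin using (Fin)
open import Data.Fin.Subset using (Subset; _∈_; _∉_; ⁅_⁆; _∪_; _-_)
open import Data.Bool using (Bool; true; false)
open import Data.Product using (Σ; ∃; ∃-syntax; _×_; _,_)
open import Relation.Binary.PropositionalEquality using (_≡_; _≢_)
open import Relation.Nullary using (¬_)
open import Function.Bundles using (_⇔_)

record Graph (n : ℕ) : Set where
  field
    adj     : Fin n → Fin n → Bool
    adj-sym : ∀ u v → adj u v ≡ adj v u
    adj-irr : ∀ u → adj u u ≡ false

module _ {n : ℕ} (G : Graph n) where
  open Graph G

  Adj : Fin n → Fin n → Set
  Adj u v = adj u v ≡ true

  Independent : Subset n → Set
  Independent A = ∀ x y → x ∈ A → y ∈ A → ¬ Adj x y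

  TSAdjacent : Subset n → Subset n → Set
  TSAdjacent A B = ∃[ x ] ∃[ y ]
      ( (x ∈ A × x ∉ B × (∀ z → z ∈ A → z ∉ B → z ≡ x))
      × (y ∈ B × y ∉ A × (∀ z → z ∈ B → z ∉ A → z ≡ y))
      × Adj x y )

  data _⇝_ : Subset n → Subset n → Set where
    done : ∀ {A} → Independent A → A ⇝ A
    step : ∀ {A B C} → Independent A → TSAdjacent A B → B ⇝ C → A ⇝ C

  InducedFork : Fin n → Fin n → Fin n → Fin n → Fin n → Set
  InducedFork a b c d e =
      (a ≢ b × a ≢ c × a ≢ d × a ≢ e × b ≢ c × b ≢ d × b ≢ e
        × c ≢ d × c ≢ e × d ≢ e)
    × (Adj a b × Adj a c × Adj a d × Adj d e)
    × (¬ Adj a e × ¬ Adj b c × ¬ Adj b d × ¬ Adj b e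
        × ¬ Adj c d × ¬ Adj c e)

  ForkFree : Set
  ForkFree = ∀ a b c d e → ¬ InducedFork a b c d e

  LocallyBlocked : Subset n → Subset n → Set
  LocallyBlocked X I = ∀ x → x ∈ X →
    ∃[ u ] ∃[ v ] (u ≢ v × u ∈ I × v ∈ I × Adj x u × Adj x v)

  InN : Fin n → Subset n → Set
  InN v X = ∃[ x ] (x ∈ X × Adj v x)

  Twin : Subset n → Fin n → Fin n → Set
  Twin X u v = v ∉ X × v ≢ u × Adj u v × (∀ w → w ∈ X → (Adj v w ⇔ Adj u w))

  FreeNeighbour : Subset n → Fin n → Fin n → Set
  FreeNeighbour I′ u v = v ∉ I′ × Adj u v × Independent ((I′ - u) ∪ ⁅ v ⁆)

  PermanentlyBlocked : Subset n → Subset n → Set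
  PermanentlyBlocked X I = LocallyBlocked X I ×
    (∀ I′ → I ⇝ I′ → ∀ u → InN u X → u ∈ I′ →
       ∀ v → FreeNeighbour I′ u v → Twin X u v)

{-# OPTIONS --safe #-}
-- If c has three neighbours in an independent set A and v is a free
-- neighbour of some u ∈ A ∩ N(c), then v is adjacent to c: otherwise c, two
-- further neighbours of c in A, u and v would induce a fork (c–u–v being the
-- subdivided edge).  Applied to each token slide, this shows that c keeps
-- three neighbours in every independent set reachable from I; applied to the
-- reached set, it shows that every free neighbour of a neighbour u of c is
-- again adjacent to c, i.e. a {c}-twin of u.
module Submission where

open import Defs
open import Data.Nat using (ℕ)
open import Data.Fin using (Fin; _≟_)
open import Data.Fin.Subset using (Subset; _∈_; _∉_; ⁅_⁆)
open import Data.Fin.Subset.Properties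
  using (_∈?_; x∈⁅x⁆; x∈⁅y⁆⇒x≡y; x≢y⇒x∉⁅y⁆; x∈p∪q⁺; x∈p∧x∉q⇒x∈p─q)
import Data.Bool as Bool
open import Data.Product using (∃-syntax; _×_; _,_)
open import Data.Sum using (inj₁; inj₂)
open import Function using (_∘_; const)
open import Function.Bundles using (_⇔_; mk⇔)
open import Relation.Nullary using (¬_; yes; no; contradiction)
open import Relation.Nullary.Decidable using (decidable-stable)
open import Relation.Binary.Definitions using (Decidable)
open import Relation.Binary.PropositionalEquality using (_≡_; _≢_; refl; sym; trans)

module _ {n : ℕ} (G : Graph n) where
  open Graph G

  private variable
    A B : Subset n
    c u v x z : Fin n

  Adj-sym : Adj G u v → Adj G v u
  Adj-sym {u} {v} = trans (adj-sym v u)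

  Adj⇒≢ : Adj G u v → u ≢ v
  Adj⇒≢ {u} uv refl with trans (sym (adj-irr u)) uv
  ... | ()

  Adj? : Decidable (Adj G)
  Adj? u v = adj u v Bool.≟ Bool.true

  ∈∧∉⇒≢ : u ∈ A → v ∉ A → u ≢ v
  ∈∧∉⇒≢ u∈A v∉A refl = v∉A u∈A

  ⇝⇒Independentˡ : _⇝_ G A B → Independent G A
  ⇝⇒Independentˡ (done indA)     = indA
  ⇝⇒Independentˡ (step indA _ _) = indA

  ⇝⇒Independentʳ : _⇝_ G A B → Independent G B
  ⇝⇒Independentʳ (done indB)   = indB
  ⇝⇒Independentʳ (step _ _ r) = ⇝⇒Independentʳ r

  remains : (∀ z → z ∈ A → z ∉ B → z ≡ x) → z ∈ A → z ≢ x → z ∈ B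
  remains {B = B} {z = z} onlyRemoved z∈A z≢x with z ∈? B
  ... | yes z∈B = z∈B
  ... | no  z∉B = contradiction (onlyRemoved z z∈A z∉B) z≢x

  ThreeNeighboursIn : Subset n → Fin n → Set
  ThreeNeighboursIn A c = ∃[ a ] ∃[ b ] ∃[ d ]
    (a ≢ b × a ≢ d × b ≢ d × a ∈ A × b ∈ A × d ∈ A
      × Adj G c a × Adj G c b × Adj G c d)

  NoOtherNeighbourIn : Subset n → Fin n → Fin n → Set
  NoOtherNeighbourIn A u v = ∀ z → z ∈ A → z ≢ u → ¬ Adj G v z

  twoNeighboursAvoiding : ThreeNeighboursIn A c → ∀ u →
    ∃[ x ] ∃[ y ] (x ≢ y × x ∈ A × y ∈ A × Adj G c x × Adj G c y × x ≢ u × y ≢ u)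
  twoNeighboursAvoiding (a , b , d , a≢b , a≢d , b≢d , a∈A , b∈A , d∈A , ca , cb , cd) u
    with u ≟ a | u ≟ b
  ... | yes refl | _        = b , d , b≢d , b∈A , d∈A , cb , cd , a≢b ∘ sym , a≢d ∘ sym
  ... | no  u≢a  | yes refl = a , d , a≢d , a∈A , d∈A , ca , cd , a≢b , b≢d ∘ sym
  ... | no  u≢a  | no  u≢b  = a , b , a≢b , a∈A , b∈A , ca , cb , u≢a ∘ sym , u≢b ∘ sym

  FreeNeighbour⇒NoOtherNeighbourIn : FreeNeighbour G A u v → NoOtherNeighbourIn A u v
  FreeNeighbour⇒NoOtherNeighbourIn {v = v} (_ , _ , ind) z z∈A z≢u =
    ind v z (x∈p∪q⁺ (inj₂ (x∈⁅x⁆ v)))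
            (x∈p∪q⁺ (inj₁ (x∈p∧x∉q⇒x∈p─q z∈A (x≢y⇒x∉⁅y⁆ z≢u))))

  module _ (forkFree : ForkFree G) where

    NoOtherNeighbourIn⇒Adj : Independent G A → ThreeNeighboursIn A c →
      u ∈ A → Adj G u c → v ∉ A → Adj G u v → NoOtherNeighbourIn A u v →
      Adj G v c
    NoOtherNeighbourIn⇒Adj {c = c} {u = u} {v = v} ind three u∈A uc v∉A uv noOther
      with twoNeighboursAvoiding three u
    ... | x , y , x≢y , x∈A , y∈A , cx , cy , x≢u , y≢u =
      decidable-stable (Adj? v c) λ ¬vc → forkFree c x y u v
        ( ( Adj⇒≢ cx , Adj⇒≢ cy , Adj⇒≢ (Adj-sym uc)
          , (λ { refl → noOther x x∈A x≢u cx })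
          , x≢y , x≢u , ∈∧∉⇒≢ x∈A v∉A , y≢u , ∈∧∉⇒≢ y∈A v∉A , ∈∧∉⇒≢ u∈A v∉A )
        , (cx , cy , Adj-sym uc , uv)
        , ( ¬vc ∘ Adj-sym , ind x y x∈A y∈A , ind x u x∈A u∈A
          , noOther x x∈A x≢u ∘ Adj-sym , ind y u y∈A u∈A
          , noOther y y∈A y≢u ∘ Adj-sym ) )

    ThreeNeighboursIn-TSAdjacent : Independent G A → Independent G B →
      TSAdjacent G A B → ThreeNeighboursIn A c → ThreeNeighboursIn B c
    ThreeNeighboursIn-TSAdjacent {A} {B} {c} indA indB
      (x , y , (x∈A , _ , onlyRemoved) , (y∈B , y∉A , _) , xy) three
      with Adj? x c
    ... | no ¬xc =
      let (a , b , d , a≢b , a≢d , b≢d , a∈A , b∈A , d∈A , ca , cb , cd) = three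
          kept : ∀ {z} → z ∈ A → Adj G c z → z ∈ B
          kept z∈A cz = remains onlyRemoved z∈A λ { refl → ¬xc (Adj-sym cz) }
      in a , b , d , a≢b , a≢d , b≢d , kept a∈A ca , kept b∈A cb , kept d∈A cd , ca , cb , cd
    ... | yes xc =
      let (p , q , p≢q , p∈A , q∈A , cp , cq , p≢x , q≢x) = twoNeighboursAvoiding three x
          yc : Adj G y c
          yc = NoOtherNeighbourIn⇒Adj indA three x∈A xc y∉A xy
                 λ z z∈A z≢x → indB y z y∈B (remains onlyRemoved z∈A z≢x)
      in p , q , y , p≢q , ∈∧∉⇒≢ p∈A y∉A , ∈∧∉⇒≢ q∈A y∉A
           , remains onlyRemoved p∈A p≢x , remains onlyRemoved q∈A q≢x , y∈B
           , cp , cq , Adj-sym yc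

    ThreeNeighboursIn-⇝ : _⇝_ G A B → ThreeNeighboursIn A c → ThreeNeighboursIn B c
    ThreeNeighboursIn-⇝ (done _)          three = three
    ThreeNeighboursIn-⇝ (step indA slide r) three =
      ThreeNeighboursIn-⇝ r (ThreeNeighboursIn-TSAdjacent indA (⇝⇒Independentˡ r) slide three)

    FreeNeighbour⇒Twin : Independent G A → ThreeNeighboursIn A c →
      u ∈ A → Adj G u c → FreeNeighbour G A u v → Twin G ⁅ c ⁆ u v
    FreeNeighbour⇒Twin {c = c} {u = u} {v = v} ind three u∈A uc free@(v∉A , uv , _) =
        (λ v∈⁅c⁆ → Adj⇒≢ vc (x∈⁅y⁆⇒x≡y c v∈⁅c⁆))
      , Adj⇒≢ (Adj-sym uv)
      , uv
      , λ _ → sameAdjToCentre ∘ x∈⁅y⁆⇒x≡y c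
      where
      vc : Adj G v c
      vc = NoOtherNeighbourIn⇒Adj ind three u∈A uc v∉A uv
             (FreeNeighbour⇒NoOtherNeighbourIn free)
      sameAdjToCentre : ∀ {w} → w ≡ c → Adj G v w ⇔ Adj G u w
      sameAdjToCentre refl = mk⇔ (const uc) (const vc)

mainTheorem6 : ∀ {n : ℕ} (G : Graph n) → ForkFree G →
    ∀ (I : Subset n) → Independent G I →
    ∀ (c : Fin n) →
    (∃[ a ] ∃[ b ] ∃[ d ] (a ≢ b × a ≢ d × b ≢ d × a ∈ I × b ∈ I × d ∈ I
       × Adj G c a × Adj G c b × Adj G c d)) →
    PermanentlyBlocked G ⁅ c ⁆ I
mainTheorem6 G forkFree I _ c three@(a , b , _ , a≢b , _ , _ , a∈I , b∈I , _ , ca , cb , _) =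
  locallyBlocked , permanentlyBlocked
  where
  locallyBlocked : LocallyBlocked G ⁅ c ⁆ I
  locallyBlocked x x∈⁅c⁆ with refl ← x∈⁅y⁆⇒x≡y c x∈⁅c⁆ = a , b , a≢b , a∈I , b∈I , ca , cb

  permanentlyBlocked : ∀ I′ → _⇝_ G I I′ → ∀ u → InN G u ⁅ c ⁆ → u ∈ I′ →
    ∀ v → FreeNeighbour G I′ u v → Twin G ⁅ c ⁆ u v
  permanentlyBlocked _ I⇝I′ _ (_ , w∈⁅c⁆ , uw) u∈I′ _ free
    with refl ← x∈⁅y⁆⇒x≡y c w∈⁅c⁆ =
    FreeNeighbour⇒Twin G forkFree (⇝⇒Independentʳ G I⇝I′)
      (ThreeNeighboursIn-⇝ G forkFree I⇝I′ three) u∈I′ uw free
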